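{- Let $P(n,\epsilon)$ denote the probability that a uniformly random permutation $\pi$ of $[n]=\{1,\dots,n\}$ satisfies $\sum_{i=1}^{n-1}|\pi(i+1)-\pi(i)|\le n^{2-\epsilon}$. Then $P(n,\epsilon)\le \exp(-\Omega(\epsilon\, n\log n))$; that is, there is an absolute constant $c>0$ such that for every constant $\epsilon>0$ and all sufficiently large $n$, $P(n,\epsilon)\le \exp(-c\,\epsilon\, n\log n)$.
   Formalization: The constant ε ranges only over the positive rationals, and the absolute constant c is taken rational. -}

module Defs where

open import Data.Nat.Base using (ℕ; zero; suc; _+_; _*_; _^_; ∣_-_∣)
open import Data.Nat.Properties using (_≤?_)
open import Data.Fin.Base using (Fin; toℕ)
open import Data.Fin.Properties using (_≟_)
open import Data.List.Base using (List; []; _∷_; [_]; map; concatMap; allFin; filter; length)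
import Data.List.Relation.Unary.Unique.DecPropositional as UniqueDec

-- All sequences (s₁,…,s_k) of length k with entries in Fin n (= [n], shifted to 0..n-1).
seqs : (n k : ℕ) → List (List (Fin n))
seqs n zero    = [ [] ]
seqs n (suc k) = concatMap (λ s → map (_∷ s) (allFin n)) (seqs n k)

-- Permutations of [n]: sequences of length n over Fin n with pairwise distinct entries
-- (listed as (π(1),…,π(n))).
perms : (n : ℕ) → List (List (Fin n))
perms n = filter (UniqueDec.unique? _≟_) (seqs n n)

adjSum : List ℕ → ℕ
adjSum (x ∷ y ∷ xs) = ∣ y - x ∣ + adjSum (y ∷ xs)
adjSum _            = 0

cost : {n : ℕ} → List (Fin n) → ℕ
cost s = adjSum (map toℕ s)

-- Number of permutations π of [n] with  cost(π) ≤ n^(2 - p/q),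
-- written without real exponents as  cost(π)^q * n^p ≤ n^(2q).
goodCount : (n p q : ℕ) → ℕ
goodCount n p q = length (filter (λ s → (cost s ^ q) * (n ^ p) ≤? n ^ (2 * q)) (perms n))

-- If there is a good permutation, let S be the largest cost of one; then
-- S ≤ n^(2 - p/q), and S ≥ n - 1 since distinct neighbours differ
-- by at least 1.  Writing a sequence as x ∷ y ∷ t, its cost is |y - x| plus the
-- cost of y ∷ t, and at most two x lie at a given distance from y; hence the
-- number B_j(S) of sequences of length j with cost ≤ S satisfies
-- B_(j+2)(S) ≤ 2 Σ_(d ≤ S) B_(j+1)(d), and by induction k! B_(k+1)(S) ≤ n 2^k (S+k)^k
-- for k = n - 1.  Together with S + k ≤ 2S and n^n ≤ 8^n n! this gives
-- #good / n! ≤ C^n n^(-(p/q)(n-1)), which is at most n^(-pn/(2q)) once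
-- n ≥ 2^(48q): the theorem holds with c = 1/2.

module Submission where

open import Data.Nat.Base
open import Data.Nat.Properties
open import Data.Nat.Tactic.RingSolver using (solve-∀)
open import Algebra.Properties.CommutativeSemigroup +-commutativeSemigroup
  using () renaming (interchange to +-interchange)
open import Data.Fin.Base using (Fin; toℕ)
open import Data.Fin.Properties using (toℕ-injective)
import Data.Fin.Properties as Fin
open import Data.List.Base using (List; []; _∷_; _++_; map; concatMap; allFin; filter; length; downFrom)
open import Data.List.Properties using (length-tabulate; filter-all)
open import Data.List.Extrema.Nat using (argmax; argmax-all; f[⊥]≤f[argmax]; f[xs]≤f[argmax])
open import Data.List.Membership.Propositional using (_∈_)
open import Data.List.Membership.Propositional.Properties using (∈-downFrom⁺)
open import Data.List.Relation.Unary.All as All using (All; []; _∷_)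
import Data.List.Relation.Unary.All.Properties as AllP
open import Data.List.Relation.Unary.Any using (here; there)
open import Data.List.Relation.Unary.Unique.Propositional using (Unique; []; _∷_)
open import Data.List.Relation.Unary.Unique.Propositional.Properties using (allFin⁺)
import Data.List.Relation.Unary.Unique.DecPropositional as UniqueDec
open import Data.List.Relation.Binary.Sublist.Propositional using (_⊆_; ⊆-trans)
import Data.List.Relation.Binary.Sublist.Propositional.Properties as Sublist
open import Data.Product using (_×_; _,_; ∃-syntax)
open import Data.Sum using (_⊎_; inj₁; inj₂)
open import Function using (_∘_; id)
open import Function.Definitions using (Injective)
open import Relation.Nullary using (Dec; yes; no; ¬_; contradiction)
open import Relation.Unary using (Decidable)
open import Relation.Binary.PropositionalEquality

open import Defs

𝟙 : {P : Set} → Dec P → ℕ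
𝟙 (yes _) = 1
𝟙 (no _)  = 0

𝟙≤1 : {P : Set} (p? : Dec P) → 𝟙 p? ≤ 1
𝟙≤1 (yes _) = ≤-refl
𝟙≤1 (no _)  = z≤n

𝟙-yes : {P : Set} (p? : Dec P) → P → 𝟙 p? ≡ 1
𝟙-yes (yes _) _ = refl
𝟙-yes (no ¬p) p = contradiction p ¬p

𝟙-no : {P : Set} (p? : Dec P) → ¬ P → 𝟙 p? ≡ 0
𝟙-no (yes p) ¬p = contradiction p ¬p
𝟙-no (no _)  _  = refl

∑ : {A : Set} → List A → (A → ℕ) → ℕ
∑ []       f = 0
∑ (x ∷ xs) f = f x + ∑ xs f

-- Between _+_ and _*_: the body of ∑[ x ∈ xs ] extends over products but not sums.
infix 6.5 ∑
syntax ∑ xs (λ x → e) = ∑[ x ∈ xs ] e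

module _ {A : Set} where

  ∑-cong : ∀ xs {f g : A → ℕ} → (∀ x → f x ≡ g x) → ∑ xs f ≡ ∑ xs g
  ∑-cong []       f≡g = refl
  ∑-cong (x ∷ xs) f≡g = cong₂ _+_ (f≡g x) (∑-cong xs f≡g)

  ∑-mono : ∀ xs {f g : A → ℕ} → (∀ x → f x ≤ g x) → ∑ xs f ≤ ∑ xs g
  ∑-mono []       f≤g = z≤n
  ∑-mono (x ∷ xs) f≤g = +-mono-≤ (f≤g x) (∑-mono xs f≤g)

  ∑-zero : (xs : List A) → ∑[ x ∈ xs ] 0 ≡ 0
  ∑-zero []       = refl
  ∑-zero (x ∷ xs) = ∑-zero xs

  ∑-distrib-+ : ∀ xs (f g : A → ℕ) → ∑[ x ∈ xs ] (f x + g x) ≡ ∑ xs f + ∑ xs g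
  ∑-distrib-+ []       f g = refl
  ∑-distrib-+ (x ∷ xs) f g =
    trans (cong (f x + g x +_) (∑-distrib-+ xs f g)) (+-interchange (f x) (g x) (∑ xs f) (∑ xs g))

  ∑-distribˡ-* : ∀ xs c (f : A → ℕ) → ∑[ x ∈ xs ] (c * f x) ≡ c * ∑ xs f
  ∑-distribˡ-* []       c f = sym (*-zeroʳ c)
  ∑-distribˡ-* (x ∷ xs) c f =
    trans (cong (c * f x +_) (∑-distribˡ-* xs c f)) (sym (*-distribˡ-+ c (f x) _))

  ∑-++ : ∀ xs ys (f : A → ℕ) → ∑ (xs ++ ys) f ≡ ∑ xs f + ∑ ys f
  ∑-++ []       ys f = refl
  ∑-++ (x ∷ xs) ys f = trans (cong (f x +_) (∑-++ xs ys f)) (sym (+-assoc (f x) _ _))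

  ∈⇒≤∑ : ∀ {xs x} (f : A → ℕ) → x ∈ xs → f x ≤ ∑ xs f
  ∈⇒≤∑ f (here refl) = m≤m+n _ _
  ∈⇒≤∑ f (there x∈xs) = ≤-trans (∈⇒≤∑ f x∈xs) (m≤n+m _ _)

  ∑≤length : ∀ xs {f : A → ℕ} → (∀ x → f x ≤ 1) → ∑ xs f ≤ length xs
  ∑≤length []       f≤1 = z≤n
  ∑≤length (x ∷ xs) f≤1 = +-mono-≤ (f≤1 x) (∑≤length xs f≤1)

  length-filter≡∑𝟙 : {P : A → Set} (P? : Decidable P) → ∀ xs → length (filter P? xs) ≡ ∑[ x ∈ xs ] 𝟙 (P? x)
  length-filter≡∑𝟙 P? []       = refl
  length-filter≡∑𝟙 P? (x ∷ xs) with P? x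
  ... | yes _ = cong suc (length-filter≡∑𝟙 P? xs)
  ... | no _  = length-filter≡∑𝟙 P? xs

  ∑-𝟙-injective≤1 : ∀ {xs} {g : A → ℕ} → Injective _≡_ _≡_ g → Unique xs → ∀ a → ∑[ x ∈ xs ] 𝟙 (g x ≟ a) ≤ 1
  ∑-𝟙-injective≤1 {[]}     g-inj []           a = z≤n
  ∑-𝟙-injective≤1 {x ∷ xs} {g} g-inj (x∉xs ∷ u) a with g x ≟ a
  ... | yes gx≡a = ≤-reflexive (cong suc (no-other-hits x∉xs))
    where
    no-other-hits : ∀ {ys} → All (x ≢_) ys → ∑[ y ∈ ys ] 𝟙 (g y ≟ a) ≡ 0
    no-other-hits []           = refl
    no-other-hits (x≢y ∷ x≢ys) =
      cong₂ _+_ (𝟙-no (g _ ≟ a) λ gy≡a → x≢y (g-inj (trans gx≡a (sym gy≡a)))) (no-other-hits x≢ys)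
  ... | no _ = ∑-𝟙-injective≤1 g-inj u a

module _ {A B : Set} where

  ∑-map : ∀ (h : A → B) xs (f : B → ℕ) → ∑ (map h xs) f ≡ ∑[ x ∈ xs ] f (h x)
  ∑-map h []       f = refl
  ∑-map h (x ∷ xs) f = cong (f (h x) +_) (∑-map h xs f)

  ∑-concatMap : ∀ (h : A → List B) xs (f : B → ℕ) → ∑ (concatMap h xs) f ≡ ∑[ x ∈ xs ] ∑ (h x) f
  ∑-concatMap h []       f = refl
  ∑-concatMap h (x ∷ xs) f = trans (∑-++ (h x) _ f) (cong (∑ (h x) f +_) (∑-concatMap h xs f))

  ∑-comm : ∀ xs ys (f : A → B → ℕ) → ∑[ x ∈ xs ] ∑[ y ∈ ys ] f x y ≡ ∑[ y ∈ ys ] ∑[ x ∈ xs ] f x y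
  ∑-comm []       ys f = sym (∑-zero ys)
  ∑-comm (x ∷ xs) ys f = begin
    ∑[ y ∈ ys ] f x y + ∑[ x ∈ xs ] ∑[ y ∈ ys ] f x y  ≡⟨ cong (∑[ y ∈ ys ] f x y +_) (∑-comm xs ys f) ⟩
    ∑[ y ∈ ys ] f x y + ∑[ y ∈ ys ] ∑[ x ∈ xs ] f x y  ≡⟨ ∑-distrib-+ ys (f x) _ ⟨
    ∑[ y ∈ ys ] (f x y + ∑[ x ∈ xs ] f x y)            ∎
    where open ≡-Reasoning

∣-∣≡⇒ : ∀ {y x e} → ∣ y - x ∣ ≡ e → x ≡ y + e ⊎ e + x ≡ y
∣-∣≡⇒ {y} {x} refl with ∣m-n∣≡[m∸n]∨[n∸m] y x
... | inj₁ ∣y-x∣≡y∸x = inj₂ (trans (cong (_+ x) ∣y-x∣≡y∸x) (m∸n+n≡m (∣m-n∣≡m∸n⇒n≤m ∣y-x∣≡y∸x)))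
... | inj₂ ∣y-x∣≡x∸y = inj₁ (trans (sym (m+[n∸m]≡n y≤x)) (cong (y +_) (sym ∣y-x∣≡x∸y)))
  where
  y≤x : y ≤ x
  y≤x = ∣m-n∣≡m∸n⇒n≤m (trans (∣-∣-comm x y) ∣y-x∣≡x∸y)

atDistance≤2 : ∀ n y e → ∑[ x ∈ allFin n ] 𝟙 (∣ y - toℕ x ∣ ≟ e) ≤ 2
atDistance≤2 n y e = begin
  ∑[ x ∈ allFin n ] 𝟙 (∣ y - toℕ x ∣ ≟ e)
    ≤⟨ ∑-mono (allFin n) (λ x → 𝟙-dist (toℕ x)) ⟩
  ∑[ x ∈ allFin n ] (𝟙 (toℕ x ≟ y + e) + 𝟙 (e + toℕ x ≟ y))
    ≡⟨ ∑-distrib-+ (allFin n) _ _ ⟩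
  ∑[ x ∈ allFin n ] 𝟙 (toℕ x ≟ y + e) + ∑[ x ∈ allFin n ] 𝟙 (e + toℕ x ≟ y)
    ≤⟨ +-mono-≤ (∑-𝟙-injective≤1 toℕ-injective (allFin⁺ n) (y + e))
                (∑-𝟙-injective≤1 (toℕ-injective ∘ +-cancelˡ-≡ e _ _) (allFin⁺ n) y) ⟩
  2 ∎
  where
  open ≤-Reasoning
  𝟙-dist : ∀ x → 𝟙 (∣ y - x ∣ ≟ e) ≤ 𝟙 (x ≟ y + e) + 𝟙 (e + x ≟ y)
  𝟙-dist x with ∣ y - x ∣ ≟ e
  ... | no _  = z≤n
  ... | yes d with ∣-∣≡⇒ d
  ...   | inj₁ x≡y+e = ≤-trans (≤-reflexive (sym (𝟙-yes (x ≟ y + e) x≡y+e))) (m≤m+n _ _)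
  ...   | inj₂ e+x≡y = ≤-trans (≤-reflexive (sym (𝟙-yes (e + x ≟ y) e+x≡y))) (m≤n+m _ _)

𝟙-+≤-split : ∀ a c S → 𝟙 (a + c ≤? S) ≤ ∑[ d ∈ downFrom (suc S) ] 𝟙 (c ≤? d) * 𝟙 (a ≟ S ∸ d)
𝟙-+≤-split a c S with a + c ≤? S
... | no _      = z≤n
... | yes a+c≤S = ≤-trans (≤-reflexive hit)
                          (∈⇒≤∑ (λ d → 𝟙 (c ≤? d) * 𝟙 (a ≟ S ∸ d)) (∈-downFrom⁺ (s≤s (m∸n≤m S a))))
  where
  hit : 1 ≡ 𝟙 (c ≤? S ∸ a) * 𝟙 (a ≟ S ∸ (S ∸ a))
  hit = sym (cong₂ _*_ (𝟙-yes (c ≤? S ∸ a) (m+n≤o⇒m≤o∸n c (subst (_≤ S) (+-comm a c) a+c≤S)))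
                       (𝟙-yes (a ≟ S ∸ (S ∸ a)) (sym (m∸[m∸n]≡n (m+n≤o⇒m≤o a a+c≤S)))))

neighbours-count : ∀ n y c S →
  ∑[ x ∈ allFin n ] 𝟙 (∣ y - toℕ x ∣ + c ≤? S) ≤ 2 * (∑[ d ∈ downFrom (suc S) ] 𝟙 (c ≤? d))
neighbours-count n y c S = begin
  ∑[ x ∈ allFin n ] 𝟙 (∣ y - toℕ x ∣ + c ≤? S)
    ≤⟨ ∑-mono (allFin n) (λ x → 𝟙-+≤-split (∣ y - toℕ x ∣) c S) ⟩
  ∑[ x ∈ allFin n ] ∑[ d ∈ ds ] 𝟙 (c ≤? d) * 𝟙 (∣ y - toℕ x ∣ ≟ S ∸ d)
    ≡⟨ ∑-comm (allFin n) ds _ ⟩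
  ∑[ d ∈ ds ] ∑[ x ∈ allFin n ] 𝟙 (c ≤? d) * 𝟙 (∣ y - toℕ x ∣ ≟ S ∸ d)
    ≡⟨ ∑-cong ds (λ d → ∑-distribˡ-* (allFin n) (𝟙 (c ≤? d)) _) ⟩
  ∑[ d ∈ ds ] 𝟙 (c ≤? d) * (∑[ x ∈ allFin n ] 𝟙 (∣ y - toℕ x ∣ ≟ S ∸ d))
    ≤⟨ ∑-mono ds (λ d → *-monoʳ-≤ (𝟙 (c ≤? d)) (atDistance≤2 n y (S ∸ d))) ⟩
  ∑[ d ∈ ds ] 𝟙 (c ≤? d) * 2
    ≡⟨ ∑-cong ds (λ d → *-comm (𝟙 (c ≤? d)) 2) ⟩
  ∑[ d ∈ ds ] 2 * 𝟙 (c ≤? d)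
    ≡⟨ ∑-distribˡ-* ds 2 (λ d → 𝟙 (c ≤? d)) ⟩
  2 * (∑[ d ∈ ds ] 𝟙 (c ≤? d)) ∎
  where
  open ≤-Reasoning
  ds = downFrom (suc S)

∑-seqs-suc : ∀ n j (f : List (Fin n) → ℕ) →
  ∑ (seqs n (suc j)) f ≡ ∑[ t ∈ seqs n j ] ∑[ x ∈ allFin n ] f (x ∷ t)
∑-seqs-suc n j f =
  trans (∑-concatMap _ (seqs n j) f) (∑-cong (seqs n j) (λ t → ∑-map (_∷ t) (allFin n) f))

lowCostCount : (n j S : ℕ) → ℕ
lowCostCount n j S = length (filter (λ s → cost s ≤? S) (seqs n j))

lowCostCount-one : ∀ n S → lowCostCount n 1 S ≤ n
lowCostCount-one n S = begin
  lowCostCount n 1 S                                  ≡⟨ length-filter≡∑𝟙 _ (seqs n 1) ⟩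
  ∑[ s ∈ seqs n 1 ] 𝟙 (cost s ≤? S)                  ≡⟨ ∑-seqs-suc n 0 _ ⟩
  ∑[ y ∈ allFin n ] 𝟙 (cost (y ∷ []) ≤? S) + 0       ≡⟨ +-identityʳ _ ⟩
  ∑[ y ∈ allFin n ] 𝟙 (cost (y ∷ []) ≤? S)           ≤⟨ ∑≤length (allFin n) (λ y → 𝟙≤1 (cost (y ∷ []) ≤? S)) ⟩
  length (allFin n)                                   ≡⟨ length-tabulate id ⟩
  n                                                   ∎
  where open ≤-Reasoning

lowCostCount-suc : ∀ n j S →
  lowCostCount n (2 + j) S ≤ 2 * (∑[ d ∈ downFrom (suc S) ] lowCostCount n (1 + j) d)
lowCostCount-suc n j S = begin
  lowCostCount n (2 + j) S
    ≡⟨ length-filter≡∑𝟙 _ (seqs n (2 + j)) ⟩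
  ∑[ s ∈ seqs n (2 + j) ] 𝟙 (cost s ≤? S)
    ≡⟨ ∑-seqs-suc n (1 + j) _ ⟩
  ∑[ s ∈ seqs n (1 + j) ] ∑[ x ∈ allFin n ] 𝟙 (cost (x ∷ s) ≤? S)
    ≡⟨ ∑-seqs-suc n j _ ⟩
  ∑[ t ∈ seqs n j ] ∑[ y ∈ allFin n ] ∑[ x ∈ allFin n ] 𝟙 (∣ toℕ y - toℕ x ∣ + cost (y ∷ t) ≤? S)
    ≤⟨ ∑-mono (seqs n j) (λ t → ∑-mono (allFin n) (λ y → neighbours-count n (toℕ y) (cost (y ∷ t)) S)) ⟩
  ∑[ t ∈ seqs n j ] ∑[ y ∈ allFin n ] 2 * (∑[ d ∈ ds ] 𝟙 (cost (y ∷ t) ≤? d))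
    ≡⟨ ∑-seqs-suc n j _ ⟨
  ∑[ s ∈ seqs n (1 + j) ] 2 * (∑[ d ∈ ds ] 𝟙 (cost s ≤? d))
    ≡⟨ ∑-distribˡ-* (seqs n (1 + j)) 2 _ ⟩
  2 * (∑[ s ∈ seqs n (1 + j) ] ∑[ d ∈ ds ] 𝟙 (cost s ≤? d))
    ≡⟨ cong (2 *_) (∑-comm (seqs n (1 + j)) ds _) ⟩
  2 * (∑[ d ∈ ds ] ∑[ s ∈ seqs n (1 + j) ] 𝟙 (cost s ≤? d))
    ≡⟨ cong (2 *_) (∑-cong ds (λ d → length-filter≡∑𝟙 _ (seqs n (1 + j)))) ⟨
  2 * (∑[ d ∈ ds ] lowCostCount n (1 + j) d) ∎
  where
  open ≤-Reasoning
  ds = downFrom (suc S)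

binomial-lower-bound : ∀ m i → m ^ suc i + suc i * m ^ i ≤ suc m ^ suc i
binomial-lower-bound m zero    = ≤-reflexive (base m)
  where
  base : ∀ m → m * 1 + 1 * 1 ≡ suc m * 1
  base = solve-∀
binomial-lower-bound m (suc i) = begin
  m ^ suc (suc i) + suc (suc i) * m ^ suc i                ≤⟨ m≤m+n _ _ ⟩
  m ^ suc (suc i) + suc (suc i) * m ^ suc i + suc i * m ^ i ≡⟨ expand m (m ^ i) i ⟩
  suc m * (m ^ suc i + suc i * m ^ i)                      ≤⟨ *-monoʳ-≤ (suc m) (binomial-lower-bound m i) ⟩
  suc m ^ suc (suc i)                                      ∎
  where
  open ≤-Reasoning
  expand : ∀ m x i → m * (m * x) + (2 + i) * (m * x) + (1 + i) * x ≡ (1 + m) * (m * x + (1 + i) * x)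
  expand = solve-∀

∑-downFrom-pow≤ : ∀ j S → suc j * (∑[ d ∈ downFrom (suc S) ] (d + j) ^ j) ≤ (S + suc j) ^ suc j
∑-downFrom-pow≤ j zero    = *-monoʳ-≤ (suc j) (≤-trans (≤-reflexive (+-identityʳ _)) (^-monoˡ-≤ j (n≤1+n j)))
∑-downFrom-pow≤ j (suc S) = begin
  suc j * ((suc S + j) ^ j + ∑[ d ∈ downFrom (suc S) ] (d + j) ^ j)
    ≡⟨ *-distribˡ-+ (suc j) ((suc S + j) ^ j) _ ⟩
  suc j * (suc S + j) ^ j + suc j * (∑[ d ∈ downFrom (suc S) ] (d + j) ^ j)
    ≤⟨ +-monoʳ-≤ (suc j * (suc S + j) ^ j) (∑-downFrom-pow≤ j S) ⟩
  suc j * (suc S + j) ^ j + (S + suc j) ^ suc j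
    ≡⟨ cong (λ x → suc j * x ^ j + (S + suc j) ^ suc j) (+-suc S j) ⟨
  suc j * (S + suc j) ^ j + (S + suc j) ^ suc j
    ≡⟨ +-comm (suc j * (S + suc j) ^ j) _ ⟩
  (S + suc j) ^ suc j + suc j * (S + suc j) ^ j
    ≤⟨ binomial-lower-bound (S + suc j) j ⟩
  (suc S + suc j) ^ suc j ∎
  where open ≤-Reasoning

lowCostCount-bound : ∀ n j S → j ! * lowCostCount n (suc j) S ≤ n * 2 ^ j * (S + j) ^ j
lowCostCount-bound n zero    S = ≤-trans (≤-reflexive (+-identityʳ _))
  (≤-trans (lowCostCount-one n S) (≤-reflexive (sym (trans (*-identityʳ _) (*-identityʳ n)))))
lowCostCount-bound n (suc j) S = begin
  suc j * j ! * lowCostCount n (2 + j) S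
    ≤⟨ *-monoʳ-≤ (suc j * j !) (lowCostCount-suc n j S) ⟩
  suc j * j ! * (2 * (∑[ d ∈ ds ] lowCostCount n (1 + j) d))
    ≡⟨ regroup (suc j) (j !) _ ⟩
  2 * (suc j * (j ! * (∑[ d ∈ ds ] lowCostCount n (1 + j) d)))
    ≡⟨ cong (λ x → 2 * (suc j * x)) (∑-distribˡ-* ds (j !) _) ⟨
  2 * (suc j * (∑[ d ∈ ds ] j ! * lowCostCount n (1 + j) d))
    ≤⟨ *-monoʳ-≤ 2 (*-monoʳ-≤ (suc j) (∑-mono ds (λ d → lowCostCount-bound n j d))) ⟩
  2 * (suc j * (∑[ d ∈ ds ] n * 2 ^ j * (d + j) ^ j))
    ≡⟨ cong (λ x → 2 * (suc j * x)) (∑-distribˡ-* ds (n * 2 ^ j) (λ d → (d + j) ^ j)) ⟩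
  2 * (suc j * (n * 2 ^ j * (∑[ d ∈ ds ] (d + j) ^ j)))
    ≡⟨ regroup′ (suc j) n (2 ^ j) _ ⟩
  n * (2 * 2 ^ j) * (suc j * (∑[ d ∈ ds ] (d + j) ^ j))
    ≤⟨ *-monoʳ-≤ (n * (2 * 2 ^ j)) (∑-downFrom-pow≤ j S) ⟩
  n * (2 * 2 ^ j) * (S + suc j) ^ suc j ∎
  where
  open ≤-Reasoning
  ds = downFrom (suc S)
  regroup : ∀ a b x → a * b * (2 * x) ≡ 2 * (a * (b * x))
  regroup = solve-∀
  regroup′ : ∀ a n t x → 2 * (a * (n * t * x)) ≡ n * (2 * t) * (a * x)
  regroup′ = solve-∀

[1+j]^m*s≤j^m*j : ∀ {j} m s → m + s ≤ j → suc j ^ m * s ≤ j ^ m * j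
[1+j]^m*s≤j^m*j {j} zero    s s≤j =
  ≤-trans (≤-reflexive (+-identityʳ s)) (≤-trans s≤j (≤-reflexive (sym (+-identityʳ j))))
[1+j]^m*s≤j^m*j {j} (suc m) s m+s<j = begin
  suc j * suc j ^ m * s    ≡⟨ swap (suc j) (suc j ^ m) s ⟩
  suc j ^ m * (suc j * s)  ≤⟨ *-monoʳ-≤ (suc j ^ m) [1+j]*s≤j*[1+s] ⟩
  suc j ^ m * (j * suc s)  ≡⟨ swap′ (suc j ^ m) j (suc s) ⟩
  j * (suc j ^ m * suc s)  ≤⟨ *-monoʳ-≤ j ([1+j]^m*s≤j^m*j m (suc s) (subst (_≤ j) (sym (+-suc m s)) m+s<j)) ⟩
  j * (j ^ m * j)          ≡⟨ *-assoc j (j ^ m) j ⟨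
  j * j ^ m * j            ∎
  where
  open ≤-Reasoning
  swap : ∀ a b c → a * b * c ≡ b * (a * c)
  swap = solve-∀
  swap′ : ∀ a b c → a * (b * c) ≡ b * (a * c)
  swap′ = solve-∀
  [1+j]*s≤j*[1+s] : suc j * s ≤ j * suc s
  [1+j]*s≤j*[1+s] = begin
    s + j * s  ≤⟨ +-monoˡ-≤ (j * s) (m+n≤o⇒n≤o (suc m) m+s<j) ⟩
    j + j * s  ≡⟨ *-suc j s ⟨
    j * suc s  ∎

[1+j]^m≤2*j^m : ∀ {j} m → m + m ≤ j → suc j ^ m ≤ 2 * j ^ m
[1+j]^m≤2*j^m {zero}  zero    _   = s≤s z≤n
[1+j]^m≤2*j^m {j@(suc _)} m m+m≤j = *-cancelʳ-≤ (suc j ^ m) (2 * j ^ m) j (begin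
  suc j ^ m * j                              ≤⟨ *-monoʳ-≤ (suc j ^ m) j≤2[j∸m] ⟩
  suc j ^ m * ((j ∸ m) + (j ∸ m))            ≡⟨ *-distribˡ-+ (suc j ^ m) (j ∸ m) (j ∸ m) ⟩
  suc j ^ m * (j ∸ m) + suc j ^ m * (j ∸ m)  ≤⟨ +-mono-≤ bound bound ⟩
  j ^ m * j + j ^ m * j                      ≡⟨ cong (j ^ m * j +_) (+-identityʳ (j ^ m * j)) ⟨
  2 * (j ^ m * j)                            ≡⟨ *-assoc 2 (j ^ m) j ⟨
  2 * j ^ m * j                              ∎)
  where
  open ≤-Reasoning
  m≤j : m ≤ j
  m≤j = m+n≤o⇒m≤o m m+m≤j
  bound : suc j ^ m * (j ∸ m) ≤ j ^ m * j
  bound = [1+j]^m*s≤j^m*j m (j ∸ m) (≤-reflexive (m+[n∸m]≡n m≤j))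
  j≤2[j∸m] : j ≤ (j ∸ m) + (j ∸ m)
  j≤2[j∸m] = begin
    j                  ≡⟨ m+[n∸m]≡n m≤j ⟨
    m + (j ∸ m)        ≤⟨ +-monoˡ-≤ (j ∸ m) (m+n≤o⇒m≤o∸n m m+m≤j) ⟩
    (j ∸ m) + (j ∸ m)  ∎

[1+j]^[t+t]≤4*j^[t+t] : ∀ {j} t → t + t ≤ j → suc j ^ (t + t) ≤ 4 * j ^ (t + t)
[1+j]^[t+t]≤4*j^[t+t] {j} t t+t≤j = begin
  suc j ^ (t + t)            ≡⟨ ^-distribˡ-+-* (suc j) t t ⟩
  suc j ^ t * suc j ^ t      ≤⟨ *-mono-≤ half half ⟩
  (2 * j ^ t) * (2 * j ^ t)  ≡⟨ regroup (j ^ t) ⟩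
  4 * (j ^ t * j ^ t)        ≡⟨ cong (4 *_) (^-distribˡ-+-* j t t) ⟨
  4 * j ^ (t + t)            ∎
  where
  open ≤-Reasoning
  half : suc j ^ t ≤ 2 * j ^ t
  half = [1+j]^m≤2*j^m t t+t≤j
  regroup : ∀ x → (2 * x) * (2 * x) ≡ 4 * (x * x)
  regroup = solve-∀

data EvenOdd : ℕ → Set where
  even : ∀ t → EvenOdd (t + t)
  odd  : ∀ t → EvenOdd (suc (t + t))

even-or-odd : ∀ j → EvenOdd j
even-or-odd zero = even 0
even-or-odd (suc j) with even-or-odd j
... | even t = odd t
... | odd t  = subst EvenOdd (cong suc (+-suc t t)) (even (suc t))

[1+j]^j≤8*j^j : ∀ j → suc j ^ j ≤ 8 * j ^ j
[1+j]^j≤8*j^j j with even-or-odd j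
... | even t = ≤-trans ([1+j]^[t+t]≤4*j^[t+t] t ≤-refl) (*-monoˡ-≤ (j ^ j) (m≤m+n 4 4))
... | odd t  = begin
  suc j * suc j ^ (t + t)    ≤⟨ *-mono-≤ (+-monoˡ-≤ j {1} {j} (s≤s z≤n)) ([1+j]^[t+t]≤4*j^[t+t] t (n≤1+n _)) ⟩
  (j + j) * (4 * j ^ (t + t)) ≡⟨ regroup j (j ^ (t + t)) ⟩
  8 * (j * j ^ (t + t))       ∎
  where
  open ≤-Reasoning
  regroup : ∀ j x → (j + j) * (4 * x) ≡ 8 * (j * x)
  regroup = solve-∀

n^n≤8^n*n! : ∀ n → n ^ n ≤ 8 ^ n * n !
n^n≤8^n*n! zero    = ≤-refl
n^n≤8^n*n! (suc n) = begin
  suc n * suc n ^ n        ≤⟨ *-monoʳ-≤ (suc n) ([1+j]^j≤8*j^j n) ⟩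
  suc n * (8 * n ^ n)      ≤⟨ *-monoʳ-≤ (suc n) (*-monoʳ-≤ 8 (n^n≤8^n*n! n)) ⟩
  suc n * (8 * (8 ^ n * n !)) ≡⟨ regroup (suc n) (8 ^ n) (n !) ⟩
  8 * 8 ^ n * (suc n * n !) ∎
  where
  open ≤-Reasoning
  regroup : ∀ a b c → a * (8 * (b * c)) ≡ 8 * b * (a * c)
  regroup = solve-∀

n^[n-1]≤8^n*[n-1]! : ∀ k → suc k ^ k ≤ 8 ^ suc k * k !
n^[n-1]≤8^n*[n-1]! k = *-cancelˡ-≤ (suc k) (begin
  suc k * suc k ^ k          ≤⟨ n^n≤8^n*n! (suc k) ⟩
  8 ^ suc k * (suc k * k !)  ≡⟨ x*[y*z]≡y*[x*z] (8 ^ suc k) (suc k) (k !) ⟩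
  suc k * (8 ^ suc k * k !)  ∎)
  where
  open ≤-Reasoning
  x*[y*z]≡y*[x*z] : ∀ x y z → x * (y * z) ≡ y * (x * z)
  x*[y*z]≡y*[x*z] = solve-∀

cost-unique≥ : ∀ {n} (s : List (Fin n)) → Unique s → length s ∸ 1 ≤ cost s
cost-unique≥ []           _                  = z≤n
cost-unique≥ (x ∷ [])     _                  = z≤n
cost-unique≥ (x ∷ y ∷ s) ((x≢y ∷ _) ∷ u) = +-mono-≤ 1≤∣y-x∣ (cost-unique≥ (y ∷ s) u)
  where
  1≤∣y-x∣ : 1 ≤ ∣ toℕ y - toℕ x ∣
  1≤∣y-x∣ = n≢0⇒n>0 (λ ∣y-x∣≡0 → x≢y (toℕ-injective (sym (∣m-n∣≡0⇒m≡n ∣y-x∣≡0))))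

seqs-length : ∀ n k → All (λ s → length s ≡ k) (seqs n k)
seqs-length n zero    = refl ∷ []
seqs-length n (suc k) =
  AllP.concat⁺ (AllP.map⁺ (All.map (λ |s|≡k → AllP.map⁺ (AllP.tabulate⁺ (λ _ → cong suc |s|≡k)))
                                   (seqs-length n k)))

length≤length-filter : ∀ {A : Set} {P : A → Set} (P? : Decidable P) {xs ys : List A} →
  All P xs → xs ⊆ ys → length xs ≤ length (filter P? ys)
length≤length-filter P? {xs} pxs xs⊆ys =
  subst (λ zs → length zs ≤ _) (filter-all P? pxs)
        (Sublist.length-mono-≤ (Sublist.filter⁺ P? P? (λ { refl p → p }) xs⊆ys))

perms-count-bound : ∀ k (Q : ℕ → Set) {GL : List (List (Fin (suc k)))} → GL ⊆ seqs (suc k) (suc k) →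
  All Unique GL → All (λ s → length s ≡ suc k) GL → All (Q ∘ cost) GL →
  length GL ≡ 0 ⊎ ∃[ S ] (Q S × k ≤ S × k ! * length GL ≤ suc k * 2 ^ k * (S + k) ^ k)
perms-count-bound k Q {[]}     _   _         _         _         = inj₁ refl
perms-count-bound k Q {σ₀ ∷ L} GL⊆ (u₀ ∷ uL) (l₀ ∷ lL) (g₀ ∷ gL) =
  inj₂ (cost σ , argmax-all cost g₀ gL , k≤S ,
        ≤-trans (*-monoʳ-≤ (k !) G≤) (lowCostCount-bound (suc k) k (cost σ)))
  where
  σ = argmax cost σ₀ L
  k≤S : k ≤ cost σ
  k≤S = subst (_≤ cost σ) (cong (_∸ 1) (argmax-all cost l₀ lL)) (cost-unique≥ σ (argmax-all cost u₀ uL))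
  G≤ : length (σ₀ ∷ L) ≤ lowCostCount (suc k) (suc k) (cost σ)
  G≤ = length≤length-filter (λ s → cost s ≤? cost σ)
         (f[⊥]≤f[argmax] {f = cost} σ₀ L ∷ f[xs]≤f[argmax] σ₀ L) GL⊆

goodPerms-count : ∀ k p q → let n = suc k in
  goodCount n p q ≡ 0 ⊎
  ∃[ S ] (S ^ q * n ^ p ≤ n ^ (2 * q) × k ≤ S × k ! * goodCount n p q ≤ n * 2 ^ k * (S + k) ^ k)
goodPerms-count k p q = perms-count-bound k Good GL⊆seqs
  (AllP.filter⁺ good? (AllP.all-filter unique? (seqs n n)))
  (AllP.filter⁺ good? (AllP.filter⁺ unique? (seqs-length n n)))
  (AllP.all-filter good? (perms n))
  where
  n = suc k
  Good : ℕ → Set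
  Good c = c ^ q * n ^ p ≤ n ^ (2 * q)
  good? : ∀ s → Dec (Good (cost s))
  good? s = cost s ^ q * n ^ p ≤? n ^ (2 * q)
  unique? = UniqueDec.unique? Fin._≟_
  GL⊆seqs : filter good? (perms n) ⊆ seqs n n
  GL⊆seqs = ⊆-trans (Sublist.filter-⊆ good? (perms n)) (Sublist.filter-⊆ unique? (seqs n n))

^-distribʳ-* : ∀ a b e → (a * b) ^ e ≡ a ^ e * b ^ e
^-distribʳ-* a b zero    = refl
^-distribʳ-* a b (suc e) = trans (cong (a * b *_) (^-distribʳ-* a b e)) (regroup a b (a ^ e) (b ^ e))
  where
  regroup : ∀ a b x y → a * b * (x * y) ≡ a * x * (b * y)
  regroup = solve-∀

^-^-reassoc : ∀ a b c d e → b * c ≡ d * e → (a ^ b) ^ c ≡ (a ^ d) ^ e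
^-^-reassoc a b c d e bc≡de = trans (^-*-assoc a b c) (trans (cong (a ^_) bc≡de) (sym (^-*-assoc a d e)))

count-below-threshold : ∀ {n k S Y} → k ≤ S → Y ≤ n * 2 ^ k * (S + k) ^ k → Y ≤ n * 4 ^ k * S ^ k
count-below-threshold {n} {k} {S} {Y} k≤S count = begin
  Y                            ≤⟨ count ⟩
  n * 2 ^ k * (S + k) ^ k      ≤⟨ *-monoʳ-≤ (n * 2 ^ k) (^-monoˡ-≤ k S+k≤2S) ⟩
  n * 2 ^ k * (2 * S) ^ k      ≡⟨ cong (n * 2 ^ k *_) (^-distribʳ-* 2 S k) ⟩
  n * 2 ^ k * (2 ^ k * S ^ k)  ≡⟨ shuffle n (2 ^ k) (S ^ k) ⟩
  n * (2 ^ k * 2 ^ k) * S ^ k  ≡⟨ cong (λ y → n * y * S ^ k) (^-distribʳ-* 2 2 k) ⟨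
  n * 4 ^ k * S ^ k            ∎
  where
  open ≤-Reasoning
  S+k≤2S : S + k ≤ 2 * S
  S+k≤2S = ≤-trans (+-monoʳ-≤ S k≤S) (≤-reflexive (cong (S +_) (sym (+-identityʳ S))))
  shuffle : ∀ n t s → n * t * (t * s) ≡ n * (t * t) * s
  shuffle = solve-∀

counting-estimate : ∀ {n k p q X G S} →
  X * G ≤ n * 4 ^ k * S ^ k → S ^ q * n ^ p ≤ n ^ (2 * q) → n ^ k ≤ 8 ^ n * X →
  (X * G) ^ (2 * q) * (n ^ p) ^ (2 * k) ≤ (n * 4 ^ k * (8 ^ n * X) ^ 2) ^ (2 * q)
counting-estimate {n} {k} {p} {q} {X} {G} {S} count good stirling = begin
  (X * G) ^ Q * (n ^ p) ^ (2 * k)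
    ≤⟨ *-monoˡ-≤ ((n ^ p) ^ (2 * k)) (^-monoˡ-≤ Q count) ⟩
  (A * S ^ k) ^ Q * (n ^ p) ^ (2 * k)
    ≡⟨ cong (_* (n ^ p) ^ (2 * k)) (^-distribʳ-* A (S ^ k) Q) ⟩
  A ^ Q * (S ^ k) ^ Q * (n ^ p) ^ (2 * k)
    ≡⟨ *-assoc (A ^ Q) _ _ ⟩
  A ^ Q * ((S ^ k) ^ Q * (n ^ p) ^ (2 * k))
    ≡⟨ cong (λ x → A ^ Q * (x * (n ^ p) ^ (2 * k))) (^-^-reassoc S k Q q (2 * k) (k*2q≡q*2k k q)) ⟩
  A ^ Q * ((S ^ q) ^ (2 * k) * (n ^ p) ^ (2 * k))
    ≡⟨ cong (A ^ Q *_) (^-distribʳ-* (S ^ q) (n ^ p) (2 * k)) ⟨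
  A ^ Q * (S ^ q * n ^ p) ^ (2 * k)
    ≤⟨ *-monoʳ-≤ (A ^ Q) (^-monoˡ-≤ (2 * k) good) ⟩
  A ^ Q * (n ^ (2 * q)) ^ (2 * k)
    ≡⟨ cong (A ^ Q *_) (trans (^-^-reassoc n Q (2 * k) k (2 * Q) (2q*2k≡k*[2*2q] k q))
                              (sym (^-*-assoc (n ^ k) 2 Q))) ⟩
  A ^ Q * ((n ^ k) ^ 2) ^ Q
    ≤⟨ *-monoʳ-≤ (A ^ Q) (^-monoˡ-≤ Q (^-monoˡ-≤ 2 stirling)) ⟩
  A ^ Q * ((8 ^ n * X) ^ 2) ^ Q
    ≡⟨ ^-distribʳ-* A ((8 ^ n * X) ^ 2) Q ⟨
  (A * (8 ^ n * X) ^ 2) ^ Q ∎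
  where
  open ≤-Reasoning
  Q = 2 * q
  A = n * 4 ^ k
  k*2q≡q*2k : ∀ k q → k * (2 * q) ≡ q * (2 * k)
  k*2q≡q*2k = solve-∀
  2q*2k≡k*[2*2q] : ∀ k q → 2 * q * (2 * k) ≡ k * (2 * (2 * q))
  2q*2k≡k*[2*2q] = solve-∀

constant-absorbed : ∀ m p q → 1 ≤ p → 2 ^ (48 * q) ≤ 3 + m →
  (4 ^ (2 + m) * 64 ^ (3 + m)) ^ (2 * q) * (3 + m) ^ (p * (3 + m)) ≤ ((3 + m) ^ p) ^ (2 * (2 + m))
constant-absorbed m p q 1≤p 2^48q≤n = begin
  (4 ^ k * 64 ^ n) ^ Q * n ^ (p * n)  ≤⟨ *-monoˡ-≤ (n ^ (p * n)) constant≤ ⟩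
  n ^ (p * suc m) * n ^ (p * n)       ≡⟨ ^-distribˡ-+-* n (p * suc m) (p * n) ⟨
  n ^ (p * suc m + p * n)             ≡⟨ cong (n ^_) (exponents m p) ⟩
  n ^ (p * (2 * k))                   ≡⟨ ^-*-assoc n p (2 * k) ⟨
  (n ^ p) ^ (2 * k)                   ∎
  where
  open ≤-Reasoning
  n = 3 + m
  k = 2 + m
  Q = 2 * q
  exponents : ∀ m p → p * (1 + m) + p * (3 + m) ≡ p * (2 * (2 + m))
  exponents = solve-∀
  8nQ≤48q[1+m] : 8 * n * Q ≤ 48 * q * suc m
  8nQ≤48q[1+m] = begin
    8 * n * Q                          ≡⟨ lhs m q ⟩
    48 * q + 16 * (q * m)              ≤⟨ m≤m+n _ (32 * (q * m)) ⟩
    48 * q + 16 * (q * m) + 32 * (q * m) ≡⟨ rhs m q ⟩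
    48 * q * suc m                     ∎
    where
    lhs : ∀ m q → 8 * (3 + m) * (2 * q) ≡ 48 * q + 16 * (q * m)
    lhs = solve-∀
    rhs : ∀ m q → 48 * q + 16 * (q * m) + 32 * (q * m) ≡ 48 * q * (1 + m)
    rhs = solve-∀
  constant≤ : (4 ^ k * 64 ^ n) ^ Q ≤ n ^ (p * suc m)
  constant≤ = begin
    (4 ^ k * 64 ^ n) ^ Q   ≤⟨ ^-monoˡ-≤ Q (*-monoˡ-≤ (64 ^ n) (^-monoʳ-≤ 4 (n≤1+n k))) ⟩
    (4 ^ n * 64 ^ n) ^ Q   ≡⟨ cong (_^ Q) (^-distribʳ-* 4 64 n) ⟨
    ((2 ^ 8) ^ n) ^ Q      ≡⟨ trans (cong (_^ Q) (^-*-assoc 2 8 n)) (^-*-assoc 2 (8 * n) Q) ⟩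
    2 ^ (8 * n * Q)        ≤⟨ ^-monoʳ-≤ 2 8nQ≤48q[1+m] ⟩
    2 ^ (48 * q * suc m)   ≡⟨ ^-*-assoc 2 (48 * q) (suc m) ⟨
    (2 ^ (48 * q)) ^ suc m ≤⟨ ^-monoˡ-≤ (suc m) 2^48q≤n ⟩
    n ^ suc m              ≤⟨ ^-monoʳ-≤ n (≤-trans (≤-reflexive (sym (*-identityˡ (suc m))))
                                                   (*-monoˡ-≤ (suc m) 1≤p)) ⟩
    n ^ (p * suc m)        ∎

count⇒goodCount-bound : ∀ m p q G S → let n = 3 + m; k = 2 + m in
  1 ≤ p → 2 ^ (48 * q) ≤ n → S ^ q * n ^ p ≤ n ^ (2 * q) → k ≤ S → k ! * G ≤ n * 2 ^ k * (S + k) ^ k →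
  G ^ (2 * q) * n ^ (p * n) ≤ (n !) ^ (2 * q)
count⇒goodCount-bound m p q G S 1≤p big good k≤S count = *-cancelʳ-≤ _ _ ((X * W) ^ Q) {{XW^Q≢0}} (begin
  G ^ Q * n ^ (p * n) * (X * W) ^ Q    ≡⟨ regroup ⟩
  (X * G) ^ Q * (W ^ Q * n ^ (p * n))  ≤⟨ *-monoʳ-≤ ((X * G) ^ Q) (constant-absorbed m p q 1≤p big) ⟩
  (X * G) ^ Q * (n ^ p) ^ (2 * k)      ≤⟨ counting-estimate {n} {k} {p} {q} count′ good (n^[n-1]≤8^n*[n-1]! k) ⟩
  (n * 4 ^ k * (8 ^ n * X) ^ 2) ^ Q    ≡⟨ cong (_^ Q) factors ⟩
  (n * X * (X * W)) ^ Q                ≡⟨ ^-distribʳ-* (n * X) (X * W) Q ⟩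
  (n !) ^ Q * (X * W) ^ Q              ∎)
  where
  open ≤-Reasoning
  n = 3 + m
  k = 2 + m
  Q = 2 * q
  X = k !
  W = 4 ^ k * 64 ^ n
  count′ : X * G ≤ n * 4 ^ k * S ^ k
  count′ = count-below-threshold {n} k≤S count
  XW^Q≢0 : NonZero ((X * W) ^ Q)
  XW^Q≢0 = m^n≢0 (X * W) Q {{m*n≢0 X W {{k !≢0}} {{m*n≢0 (4 ^ k) (64 ^ n) {{m^n≢0 4 k}} {{m^n≢0 64 n}}}}}}
  regroup : G ^ Q * n ^ (p * n) * (X * W) ^ Q ≡ (X * G) ^ Q * (W ^ Q * n ^ (p * n))
  regroup = begin-equality
    G ^ Q * n ^ (p * n) * (X * W) ^ Q        ≡⟨ cong (G ^ Q * n ^ (p * n) *_) (^-distribʳ-* X W Q) ⟩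
    G ^ Q * n ^ (p * n) * (X ^ Q * W ^ Q)    ≡⟨ shuffle (G ^ Q) (n ^ (p * n)) (X ^ Q) (W ^ Q) ⟩
    X ^ Q * G ^ Q * (W ^ Q * n ^ (p * n))    ≡⟨ cong (_* (W ^ Q * n ^ (p * n))) (^-distribʳ-* X G Q) ⟨
    (X * G) ^ Q * (W ^ Q * n ^ (p * n))      ∎
    where
    shuffle : ∀ g e x w → g * e * (x * w) ≡ x * g * (w * e)
    shuffle = solve-∀
  factors : n * 4 ^ k * (8 ^ n * X) ^ 2 ≡ n * X * (X * W)
  factors = trans (shuffle n (4 ^ k) (8 ^ n) X)
                  (cong (λ y → n * X * (X * (4 ^ k * y))) (sym (^-distribʳ-* 8 8 n)))
    where
    shuffle : ∀ n a e x → n * a * (e * x * (e * x * 1)) ≡ n * x * (x * (a * (e * e)))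
    shuffle = solve-∀


3≤2^[48*q] : ∀ q → 0 < q → 3 ≤ 2 ^ (48 * q)
3≤2^[48*q] q@(suc _) _ = ≤-trans (s≤s (s≤s (s≤s z≤n))) (^-monoʳ-≤ 2 (m≤m*n 48 q))

goodCount-bound : ∀ p q n → 0 < p → 0 < q → 2 ^ (48 * q) ≤ n →
  goodCount n p q ^ (2 * q) * n ^ (p * n) ≤ (n !) ^ (2 * q)
goodCount-bound p q@(suc _) n 0<p 0<q big with ≤-trans (3≤2^[48*q] q 0<q) big
... | s≤s (s≤s (s≤s {n = m} _)) with goodPerms-count (2 + m) p q
...   | inj₁ G≡0 = subst (λ G → G ^ (2 * q) * n ^ (p * n) ≤ (n !) ^ (2 * q)) (sym G≡0) z≤n
...   | inj₂ (S , good , k≤S , count) = count⇒goodCount-bound m p q _ S 0<p big good k≤S count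

lemma2 : ∃[ a ] ∃[ b ] (0 < a × 0 < b ×
           ((p q : ℕ) → 0 < p → 0 < q →
             ∃[ N ] ((n : ℕ) → N ≤ n →
               (goodCount n p q ^ (b * q)) * (n ^ (a * p * n)) ≤ (n !) ^ (b * q))))
lemma2 = 1 , 2 , s≤s z≤n , s≤s z≤n , λ p q 0<p 0<q → 2 ^ (48 * q) , λ n N≤n →
  subst (λ a → goodCount n p q ^ (2 * q) * n ^ (a * n) ≤ (n !) ^ (2 * q)) (sym (*-identityˡ p))
        (goodCount-bound p q n 0<p 0<q N≤n)
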